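{- For all integers $d\ge 3$ and $n\ge 4$, $$\frac{d(d-1)(d-2)^{n-2}}{2d-3}\le \gamma(cDB(d,3,n))\le (d-1)(d-2)^{n-2},$$ and the upper bound equals $\bigl(2-\Theta(1/d)\bigr)\frac{d(d-1)(d-2)^{n-2}}{2d-3}$.
   Context: Let $[d]=\{1,\dots,d\}$. A sequence $(x_1,\dots,x_n)\in[d]^n$ is $t$-constrained if for all $1\le i<j\le n$ with $x_i=x_j$ one has $j-i\ge t$. For $1\le t\le\min\{d,n\}$, $V(d,t,n)$ denotes the set of $t$-constrained sequences in $[d]^n$. The directed $t$-constrained de Bruijn graph $cDB^+(d,t,n)$ is the subgraph of the directed de Bruijn graph on $[d]^n$ (arcs $(a_1,\dots,a_n)\to(a_2,\dots,a_n,a_{n+1})$) induced by $V(d,t,n)$; $cDB(d,t,n)$ is its undirected version, obtained by ignoring arc directions and removing loops and multiple edges. In an undirected graph a vertex dominates itself and its neighbours; a dominating set is a set $S$ of vertices such that every vertex is dominated by some vertex of $S$, and $\gamma(G)$ is the minimum size of a dominating set. -}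

module Defs where

open import Data.Nat using (ℕ; suc; _≤_; _∸_)
open import Data.Fin using (Fin; toℕ) renaming (_<_ to _<ᶠ_)
open import Data.Vec using (Vec; lookup)
open import Data.List using (List; length)
open import Data.List.Membership.Propositional using (_∈_)
open import Data.List.Relation.Unary.All using (All)
open import Data.List.Relation.Unary.Unique.Propositional using (Unique)
open import Data.Product using (∃; _×_; _,_)
open import Data.Sum using (_⊎_)
open import Relation.Binary.PropositionalEquality using (_≡_; _≢_)

Word : ℕ → ℕ → Set
Word d n = Vec (Fin d) n

Constrained : ∀ {d n} → ℕ → Word d n → Set
Constrained {d} {n} t x =
  (i j : Fin n) → i <ᶠ j → lookup x i ≡ lookup x j → t ≤ toℕ j ∸ toℕ i

-- de Bruijn arc a → b : (a_1,…,a_n) → (a_2,…,a_n,b_n), i.e. b_i = a_{i+1}.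
Arc : ∀ {d n} → Word d n → Word d n → Set
Arc {d} {n} a b = (i j : Fin n) → toℕ j ≡ suc (toℕ i) → lookup b i ≡ lookup a j

-- Edge of the undirected simple graph cDB(d,t,n) between two vertices of
-- V(d,t,n): distinct, and joined by an arc in some direction.
Adj : ∀ {d n} → ℕ → Word d n → Word d n → Set
Adj t a b = Constrained t a × Constrained t b × a ≢ b × (Arc a b ⊎ Arc b a)

Dominated : ∀ {d n} → ℕ → List (Word d n) → Word d n → Set
Dominated t S v = ∃ λ s → s ∈ S × (s ≡ v ⊎ Adj t s v)

-- A dominating set of cDB(d,t,n), given as a duplicate-free list (so its
-- size is its length) of vertices of V(d,t,n) dominating every vertex.
IsDominatingSet : (d t n : ℕ) → List (Word d n) → Set
IsDominatingSet d t n S =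
  Unique S × All (Constrained t) S ×
  ((v : Word d n) → Constrained t v → Dominated t S v)

-- A word is 3-constrained iff every three consecutive letters are pairwise distinct. Hence a
-- vertex of cDB(d,3,n) has at most d − 2 out-neighbours (append a letter avoiding the last two)
-- and at most d − 2 in-neighbours (prepend a letter avoiding the first two), so it dominates at
-- most 2d − 3 vertices, while there are d(d − 1)(d − 2)^(n−2) vertices: that is the lower bound.
-- For the upper bound, the (d − 1)(d − 2)^(n−2) words starting with a fixed letter a dominate:
-- a word x a … has an out-neighbour starting with a (here d ≥ 3 is needed to append a letter),
-- and a word whose first two letters differ from a has the in-neighbour a ∷ init.
module Submission where

open import Level using (Level)
open import Data.Nat using (ℕ; zero; suc; _+_; _*_; _∸_; _^_; _≤_; z≤n; s≤s)
open import Data.Nat.Properties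
  using (≤-antisym; ≤-reflexive; ≤-trans; ≤-pred; n≤1+n; suc-injective; +-suc; +-identityʳ;
         *-assoc; *-comm; ∸-+-assoc; ∸-monoˡ-≤; module ≤-Reasoning)
open import Data.Fin using (Fin; zero; suc; toℕ; _≟_)
open import Data.Vec using (Vec; []; _∷_; head; tail; last; init; _∷ʳ_; lookup)
open import Data.Vec.Properties using (∷-injective; ∷-injectiveʳ)
open import Data.List using (List; []; _∷_; _++_; [_]; length; map; concatMap; filter; allFin)
open import Data.List.Properties using (length-++; length-map; length-tabulate)
open import Data.List.Membership.Propositional using (_∈_; find; lose)
open import Data.List.Membership.Propositional.Properties
  using (∈-concatMap⁺; ∈-concatMap⁻; ∈-map⁺; ∈-map⁻; ∈-filter⁺; ∈-filter⁻; ∈-∃++; ∈-allFin; ∈-++⁺ˡ; ∈-++⁺ʳ)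
open import Data.List.Relation.Unary.Any using (here; there)
open import Data.List.Relation.Unary.All using ([]; _∷_) renaming (lookup to All-lookup; tabulate to All-tabulate)
open import Data.List.Relation.Unary.Unique.Propositional using (Unique)
open import Data.List.Relation.Unary.AllPairs using ([]; _∷_)
open import Data.List.Relation.Unary.Unique.Propositional.Properties
  using (map⁺; filter⁺; allFin⁺) renaming (++⁺ to Unique-++⁺)
open import Data.List.Relation.Binary.Subset.Propositional using (_⊆_)
open import Data.List.Relation.Binary.Permutation.Propositional.Properties using (shift; ∈-resp-↭; ↭-length)
open import Data.Product using (∃; _×_; _,_; proj₁; proj₂)
open import Data.Sum using (_⊎_; inj₁; inj₂)
open import Data.Unit.Polymorphic using (⊤)
open import Function using (_∘_; id)
open import Relation.Nullary using (¬_; ¬?; yes; no; contradiction)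
open import Relation.Binary.Definitions using (DecidableEquality)
open import Relation.Binary.PropositionalEquality
  using (_≡_; _≢_; refl; sym; trans; cong; cong₂; subst; ≢-sym; module ≡-Reasoning)

open import Defs

private variable
  ℓ : Level
  m n : ℕ

module _ {A : Set ℓ} where

  ⊆⇒length-≤ : {xs ys : List A} → Unique xs → xs ⊆ ys → length xs ≤ length ys
  ⊆⇒length-≤ {[]} _ _ = z≤n
  ⊆⇒length-≤ {x ∷ xs} {ys} (x∉xs ∷ xs!) xs⊆ys
    with ys₁ , ys₂ , refl ← ∈-∃++ (xs⊆ys (here refl)) =
    subst (suc (length xs) ≤_) (sym (↭-length (shift x ys₁ ys₂)))
          (s≤s (⊆⇒length-≤ xs! xs⊆ys₁++ys₂))
    where
    xs⊆ys₁++ys₂ : xs ⊆ ys₁ ++ ys₂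
    xs⊆ys₁++ys₂ y∈xs with ∈-resp-↭ (shift x ys₁ ys₂) (xs⊆ys (there y∈xs))
    ... | here y≡x  = contradiction (sym y≡x) (All-lookup x∉xs y∈xs)
    ... | there y∈  = y∈

  length-concatMap : {B : Set ℓ} (f : A → List B) (xs : List A) →
                     (∀ {x} → x ∈ xs → length (f x) ≡ m) → length (concatMap f xs) ≡ length xs * m
  length-concatMap f []       _   = refl
  length-concatMap f (x ∷ xs) len = trans (length-++ (f x))
    (cong₂ _+_ (len (here refl)) (length-concatMap f xs (len ∘ there)))

  length≥1⇒∃∈ : {xs : List A} → 1 ≤ length xs → ∃ (_∈ xs)
  length≥1⇒∃∈ {x ∷ _} _ = x , here refl

  branch : (A → List (Vec A n)) → List A → List (Vec A (suc n))
  branch f = concatMap (λ c → map (c ∷_) (f c))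

  ∈-branch⁺ : ∀ {f : A → List (Vec A n)} {cs c r} → c ∈ cs → r ∈ f c → c ∷ r ∈ branch f cs
  ∈-branch⁺ {f = f} c∈cs r∈fc = ∈-concatMap⁺ (λ c → map (c ∷_) (f c)) (lose c∈cs (∈-map⁺ (_ ∷_) r∈fc))

  ∈-branch⁻ : ∀ {f : A → List (Vec A n)} cs {c r} → c ∷ r ∈ branch f cs → c ∈ cs × r ∈ f c
  ∈-branch⁻ {f = f} cs ∈branch
    with c′ , c′∈cs , ∈map ← find (∈-concatMap⁻ (λ c → map (c ∷_) (f c)) {xs = cs} ∈branch)
    with r′ , r′∈ , eq ← ∈-map⁻ (c′ ∷_) ∈map
    with refl , refl ← ∷-injective eq = c′∈cs , r′∈

  branch-unique : ∀ {f : A → List (Vec A n)} {cs} → Unique cs → (∀ c → Unique (f c)) → Unique (branch f cs)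
  branch-unique {cs = []}     _           _     = []
  branch-unique {f = f} {cs = c ∷ cs} (c∉cs ∷ cs!) f-uniq =
    Unique-++⁺ (map⁺ ∷-injectiveʳ (f-uniq c)) (branch-unique cs! f-uniq) disjoint
    where
    disjoint : ∀ {v} → ¬ (v ∈ map (c ∷_) (f c) × v ∈ branch f cs)
    disjoint (v∈ , v∈branch) with r , _ , refl ← ∈-map⁻ (c ∷_) v∈ =
      contradiction (proj₁ (∈-branch⁻ cs v∈branch)) (λ c∈cs → All-lookup c∉cs c∈cs refl)

  length-branch : ∀ (f : A → List (Vec A n)) cs → (∀ {c} → c ∈ cs → length (f c) ≡ m) →
                  length (branch f cs) ≡ length cs * m
  length-branch f cs len = length-concatMap (λ c → map (c ∷_) (f c)) cs
    (λ {c} c∈cs → trans (length-map (c ∷_) (f c)) (len c∈cs))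

module _ {A : Set ℓ} (_≟ᴬ_ : DecidableEquality A) where

  without : A → List A → List A
  without x = filter (λ y → ¬? (y ≟ᴬ x))

  ∈-without⁺ : ∀ {x y xs} → y ∈ xs → y ≢ x → y ∈ without x xs
  ∈-without⁺ = ∈-filter⁺ (λ y → ¬? (y ≟ᴬ _))

  ∈-without⁻ : ∀ x xs {y} → y ∈ without x xs → y ∈ xs × y ≢ x
  ∈-without⁻ x xs = ∈-filter⁻ (λ y → ¬? (y ≟ᴬ x)) {xs = xs}

  without-unique : ∀ {x xs} → Unique xs → Unique (without x xs)
  without-unique = filter⁺ (λ y → ¬? (y ≟ᴬ _))

  -- x ∷ without x xs and xs are duplicate-free lists with the same elements.
  length-without : ∀ {x xs} → Unique xs → x ∈ xs → suc (length (without x xs)) ≡ length xs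
  length-without {x} {xs} xs! x∈xs = ≤-antisym
    (⊆⇒length-≤ (All-tabulate (λ y∈ → ≢-sym (proj₂ (∈-without⁻ x xs y∈))) ∷ without-unique xs!) ⊆xs)
    (⊆⇒length-≤ xs! xs⊆)
    where
    ⊆xs : x ∷ without x xs ⊆ xs
    ⊆xs (here refl) = x∈xs
    ⊆xs (there y∈)  = proj₁ (∈-without⁻ x xs y∈)
    xs⊆ : xs ⊆ x ∷ without x xs
    xs⊆ {y} y∈xs with y ≟ᴬ x
    ... | yes refl = here refl
    ... | no  y≢x  = there (∈-without⁺ y∈xs y≢x)

module _ {A : Set ℓ} where

  Constrained₃ : Vec A n → Set ℓ
  Constrained₃ (a ∷ b ∷ c ∷ r) = a ≢ b × a ≢ c × Constrained₃ (b ∷ c ∷ r)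
  Constrained₃ (a ∷ b ∷ [])    = a ≢ b
  Constrained₃ _               = ⊤

  penultimate : Vec A (2 + n) → A
  penultimate (a ∷ _ ∷ [])    = a
  penultimate (_ ∷ b ∷ c ∷ r) = penultimate (b ∷ c ∷ r)

  Constrained₃-tail : ∀ (a : A) (w : Vec A n) → Constrained₃ (a ∷ w) → Constrained₃ w
  Constrained₃-tail a []          _            = _
  Constrained₃-tail a (b ∷ [])    _            = _
  Constrained₃-tail a (b ∷ c ∷ r) (_ , _ , w₃) = w₃

  Constrained₃-head : ∀ {a b : A} (r : Vec A n) → Constrained₃ (a ∷ b ∷ r) → a ≢ b
  Constrained₃-head []      a≢b       = a≢b
  Constrained₃-head (_ ∷ _) (a≢b , _) = a≢b

  Constrained₃-last : ∀ (w : Vec A (2 + n)) → Constrained₃ w → penultimate w ≢ last w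
  Constrained₃-last (a ∷ b ∷ [])    a≢b          = a≢b
  Constrained₃-last (a ∷ b ∷ c ∷ r) (_ , _ , w₃) = Constrained₃-last (b ∷ c ∷ r) w₃

  Constrained₃-init : ∀ (w : Vec A (suc n)) → Constrained₃ w → Constrained₃ (init w)
  Constrained₃-init (a ∷ [])            _                = _
  Constrained₃-init (a ∷ b ∷ [])        _                = _
  Constrained₃-init (a ∷ b ∷ c ∷ [])    (a≢b , _)        = a≢b
  Constrained₃-init (a ∷ b ∷ c ∷ e ∷ r) (a≢b , a≢c , w₃) = a≢b , a≢c , Constrained₃-init (b ∷ c ∷ e ∷ r) w₃

  Constrained₃-∷ʳ⁺ : ∀ (w : Vec A (2 + n)) {c} → Constrained₃ w →
                     c ≢ last w → c ≢ penultimate w → Constrained₃ (w ∷ʳ c)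
  Constrained₃-∷ʳ⁺ (a ∷ b ∷ [])    a≢b              c≢b c≢a = a≢b , ≢-sym c≢a , ≢-sym c≢b
  Constrained₃-∷ʳ⁺ (a ∷ b ∷ e ∷ r) (a≢b , a≢e , w₃) c≢l c≢p =
    a≢b , a≢e , Constrained₃-∷ʳ⁺ (b ∷ e ∷ r) w₃ c≢l c≢p

  Constrained₃-∷ʳ⁻ : ∀ (w : Vec A (2 + n)) {c} → Constrained₃ (w ∷ʳ c) → c ≢ last w × c ≢ penultimate w
  Constrained₃-∷ʳ⁻ (a ∷ b ∷ [])    (_ , a≢c , b≢c) = ≢-sym b≢c , ≢-sym a≢c
  Constrained₃-∷ʳ⁻ (a ∷ b ∷ e ∷ r) (_ , _ , w₃)    = Constrained₃-∷ʳ⁻ (b ∷ e ∷ r) w₃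

module _ {d : ℕ} where

  Constrained-∷⁺ : ∀ {a : Fin d} {w : Word d n} → Constrained 3 w →
                   (∀ j → a ≡ lookup w j → 2 ≤ toℕ j) → Constrained 3 (a ∷ w)
  Constrained-∷⁺ w-con far zero    (suc j) _         a≡wⱼ  = s≤s (far j a≡wⱼ)
  Constrained-∷⁺ w-con far (suc i) (suc j) (s≤s i<j) wᵢ≡wⱼ = w-con i j i<j wᵢ≡wⱼ

  Constrained-∷⁻ : ∀ {a : Fin d} {w : Word d n} → Constrained 3 (a ∷ w) →
                   Constrained 3 w × (∀ j → a ≡ lookup w j → 2 ≤ toℕ j)
  Constrained-∷⁻ con = (λ i j i<j → con (suc i) (suc j) (s≤s i<j))
                     , (λ j a≡wⱼ → ≤-pred (con zero (suc j) (s≤s z≤n) a≡wⱼ))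

  Constrained₃-∷⇒far : ∀ (a : Fin d) (w : Word d n) → Constrained₃ (a ∷ w) →
                       ∀ j → a ≡ lookup w j → 2 ≤ toℕ j
  Constrained₃-∷⇒far a (b ∷ [])    a≢b           zero          a≡b = contradiction a≡b a≢b
  Constrained₃-∷⇒far a (b ∷ c ∷ r) (a≢b , _)     zero          a≡b = contradiction a≡b a≢b
  Constrained₃-∷⇒far a (b ∷ c ∷ r) (_ , a≢c , _) (suc zero)    a≡c = contradiction a≡c a≢c
  Constrained₃-∷⇒far a (b ∷ c ∷ r) _             (suc (suc j)) _   = s≤s (s≤s z≤n)

  Constrained₃⇒Constrained : (w : Word d n) → Constrained₃ w → Constrained 3 w
  Constrained₃⇒Constrained []      _   ()
  Constrained₃⇒Constrained (a ∷ w) con =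
    Constrained-∷⁺ (Constrained₃⇒Constrained w (Constrained₃-tail a w con)) (Constrained₃-∷⇒far a w con)

  Constrained⇒Constrained₃ : (w : Word d n) → Constrained 3 w → Constrained₃ w
  Constrained⇒Constrained₃ []              _   = _
  Constrained⇒Constrained₃ (a ∷ [])        _   = _
  Constrained⇒Constrained₃ (a ∷ b ∷ [])    con a≡b with () ← proj₂ (Constrained-∷⁻ con) zero a≡b
  Constrained⇒Constrained₃ (a ∷ b ∷ c ∷ r) con =
    let w-con , far = Constrained-∷⁻ con in
    (λ a≡b → contradiction (far zero a≡b) λ ())
    , (λ a≡c → contradiction (far (suc zero) a≡c) λ { (s≤s ()) })
    , Constrained⇒Constrained₃ (b ∷ c ∷ r) w-con

  Arc-∷⁻ : ∀ {a b : Fin d} {as bs : Word d n} → Arc (a ∷ as) (b ∷ bs) → Arc as bs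
  Arc-∷⁻ arc i j j≡1+i = arc (suc i) (suc j) (cong suc j≡1+i)

  Arc-∷ʳ : ∀ (x : Fin d) (w : Word d n) y → Arc (x ∷ w) (w ∷ʳ y)
  Arc-∷ʳ x []      y zero    zero       ()
  Arc-∷ʳ x (a ∷ w) y zero    (suc zero) _     = refl
  Arc-∷ʳ x (a ∷ w) y (suc i) (suc j)    j≡1+i = Arc-∷ʳ a w y i j (suc-injective j≡1+i)

  Arc-∷init : ∀ (x : Fin d) (w : Word d (suc n)) → Arc (x ∷ init w) w
  Arc-∷init x (a ∷ [])    zero    zero       ()
  Arc-∷init x (a ∷ b ∷ w) zero    (suc zero) _     = refl
  Arc-∷init x (a ∷ b ∷ w) (suc i) (suc j)    j≡1+i = Arc-∷init a (b ∷ w) i j (suc-injective j≡1+i)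

  Arc⇒≡tail∷ʳ : ∀ (a b : Word d (suc n)) → Arc a b → b ≡ tail a ∷ʳ last b
  Arc⇒≡tail∷ʳ (_ ∷ [])        (_ ∷ [])        _   = refl
  Arc⇒≡tail∷ʳ (a₀ ∷ a₁ ∷ as) (b₀ ∷ b₁ ∷ bs) arc =
    cong₂ _∷_ (arc zero (suc zero) refl) (Arc⇒≡tail∷ʳ (a₁ ∷ as) (b₁ ∷ bs) (Arc-∷⁻ arc))

  Arc⇒≡∷init : ∀ (a b : Word d (suc n)) → Arc a b → a ≡ head a ∷ init b
  Arc⇒≡∷init (_ ∷ [])        (_ ∷ [])        _   = refl
  Arc⇒≡∷init (a₀ ∷ a₁ ∷ as) (b₀ ∷ b₁ ∷ bs) arc with refl ← arc zero (suc zero) refl =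
    cong (a₀ ∷_) (Arc⇒≡∷init (a₁ ∷ as) (b₁ ∷ bs) (Arc-∷⁻ arc))

  others : Fin d → List (Fin d)
  others a = without _≟_ a (allFin d)

  others₂ : Fin d → Fin d → List (Fin d)
  others₂ a b = without _≟_ b (others a)

  ∈-others⁺ : ∀ {a c} → c ≢ a → c ∈ others a
  ∈-others⁺ = ∈-without⁺ _≟_ (∈-allFin _)

  ∈-others⁻ : ∀ {a c} → c ∈ others a → c ≢ a
  ∈-others⁻ {a} = proj₂ ∘ ∈-without⁻ _≟_ a (allFin d)

  ∈-others₂⁺ : ∀ {a b c} → c ≢ a → c ≢ b → c ∈ others₂ a b
  ∈-others₂⁺ c≢a = ∈-without⁺ _≟_ (∈-others⁺ c≢a)

  ∈-others₂⁻ : ∀ {a b c} → c ∈ others₂ a b → c ≢ a × c ≢ b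
  ∈-others₂⁻ {a} {b} c∈ = let c∈others , c≢b = ∈-without⁻ _≟_ b (others a) c∈ in
    ∈-others⁻ c∈others , c≢b

  others-unique : ∀ a → Unique (others a)
  others-unique a = without-unique _≟_ (allFin⁺ d)

  others₂-unique : ∀ a b → Unique (others₂ a b)
  others₂-unique a b = without-unique _≟_ (others-unique a)

  length-others : ∀ a → length (others a) ≡ d ∸ 1
  length-others a =
    cong (_∸ 1) (trans (length-without _≟_ (allFin⁺ d) (∈-allFin a)) (length-tabulate {n = d} id))

  length-others₂ : ∀ {a b} → b ≢ a → length (others₂ a b) ≡ d ∸ 2
  length-others₂ {a} {b} b≢a = begin
    length (others₂ a b)  ≡⟨ cong (_∸ 1) (length-without _≟_ (others-unique a) (∈-others⁺ b≢a)) ⟩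
    length (others a) ∸ 1 ≡⟨ cong (_∸ 1) (length-others a) ⟩
    d ∸ 1 ∸ 1             ≡⟨ ∸-+-assoc d 1 1 ⟩
    d ∸ 2                 ∎
    where open ≡-Reasoning

  extensions₂ : Fin d → Fin d → (m : ℕ) → List (Word d m)
  extensions₂ a b zero    = [ [] ]
  extensions₂ a b (suc m) = branch (λ c → extensions₂ b c m) (others₂ a b)

  extensions : Fin d → (m : ℕ) → List (Word d (suc m))
  extensions a m = branch (λ b → extensions₂ a b m) (others a)

  constrainedWords : (m : ℕ) → List (Word d (2 + m))
  constrainedWords m = branch (λ a → extensions a m) (allFin d)

  ∈-extensions₂⁺ : ∀ {a b} (r : Word d m) → Constrained₃ (a ∷ b ∷ r) → r ∈ extensions₂ a b m
  ∈-extensions₂⁺ []      _                = here refl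
  ∈-extensions₂⁺ (c ∷ r) (a≢b , a≢c , w₃) =
    ∈-branch⁺ (∈-others₂⁺ (≢-sym a≢c) (≢-sym (Constrained₃-head r w₃))) (∈-extensions₂⁺ r w₃)

  ∈-extensions₂⁻ : ∀ {a b} (r : Word d m) → a ≢ b → r ∈ extensions₂ a b m → Constrained₃ (a ∷ b ∷ r)
  ∈-extensions₂⁻ []      a≢b _  = a≢b
  ∈-extensions₂⁻ {a = a} {b} (c ∷ r) a≢b r∈ =
    let c∈others₂ , r∈ext = ∈-branch⁻ (others₂ a b) r∈
        c≢a , c≢b = ∈-others₂⁻ c∈others₂
    in a≢b , ≢-sym c≢a , ∈-extensions₂⁻ r (≢-sym c≢b) r∈ext

  extensions₂-unique : ∀ a b m → Unique (extensions₂ a b m)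
  extensions₂-unique a b zero    = [] ∷ []
  extensions₂-unique a b (suc m) = branch-unique (others₂-unique a b) (λ c → extensions₂-unique b c m)

  length-extensions₂ : ∀ {a b} m → a ≢ b → length (extensions₂ a b m) ≡ (d ∸ 2) ^ m
  length-extensions₂           zero    _   = refl
  length-extensions₂ {a} {b} (suc m) a≢b =
    trans (length-branch (λ c → extensions₂ b c m) (others₂ a b)
             (λ c∈ → length-extensions₂ m (≢-sym (proj₂ (∈-others₂⁻ c∈)))))
          (cong (_* (d ∸ 2) ^ m) (length-others₂ (≢-sym a≢b)))

  ∈-extensions⁺ : ∀ {a} (r : Word d (suc m)) → Constrained₃ (a ∷ r) → r ∈ extensions a m
  ∈-extensions⁺ (b ∷ r) con = ∈-branch⁺ (∈-others⁺ (≢-sym (Constrained₃-head r con))) (∈-extensions₂⁺ r con)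

  ∈-extensions⁻ : ∀ {a} (r : Word d (suc m)) → r ∈ extensions a m → Constrained₃ (a ∷ r)
  ∈-extensions⁻ {a = a} (b ∷ r) r∈ =
    let b∈others , r∈ext = ∈-branch⁻ (others a) r∈
    in ∈-extensions₂⁻ r (≢-sym (∈-others⁻ b∈others)) r∈ext

  extensions-unique : ∀ a m → Unique (extensions a m)
  extensions-unique a m = branch-unique (others-unique a) (λ b → extensions₂-unique a b m)

  length-extensions : ∀ a m → length (extensions a m) ≡ (d ∸ 1) * (d ∸ 2) ^ m
  length-extensions a m =
    trans (length-branch (λ b → extensions₂ a b m) (others a)
             (λ b∈ → length-extensions₂ m (≢-sym (∈-others⁻ b∈))))
          (cong (_* (d ∸ 2) ^ m) (length-others a))

  ∈-constrainedWords⁻ : (w : Word d (2 + m)) → w ∈ constrainedWords m → Constrained₃ w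
  ∈-constrainedWords⁻ (a ∷ r) w∈ = ∈-extensions⁻ r (proj₂ (∈-branch⁻ (allFin d) w∈))

  constrainedWords-unique : ∀ m → Unique (constrainedWords m)
  constrainedWords-unique m = branch-unique (allFin⁺ d) (λ a → extensions-unique a m)

  length-constrainedWords : ∀ m → length (constrainedWords m) ≡ d * ((d ∸ 1) * (d ∸ 2) ^ m)
  length-constrainedWords m =
    trans (length-branch (λ a → extensions a m) (allFin d) (λ {a} _ → length-extensions a m))
          (cong (_* ((d ∸ 1) * (d ∸ 2) ^ m)) (length-tabulate {n = d} id))

  adjacent : ∀ {s v : Word d (suc n)} → Constrained₃ s → Constrained₃ v → head s ≢ head v →
             Arc s v ⊎ Arc v s → Adj 3 s v
  adjacent {s = s} {v} s-con v-con heads≢ arc =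
    Constrained₃⇒Constrained s s-con , Constrained₃⇒Constrained v v-con , heads≢ ∘ cong head , arc

  outNeighbours : Word d (3 + n) → List (Word d (3 + n))
  outNeighbours (_ ∷ t) = map (t ∷ʳ_) (others₂ (last t) (penultimate t))

  inNeighbours : Word d (3 + n) → List (Word d (3 + n))
  inNeighbours s@(s₀ ∷ s₁ ∷ _) = map (_∷ init s) (others₂ s₀ s₁)

  closedNeighbourhood : Word d (3 + n) → List (Word d (3 + n))
  closedNeighbourhood s = s ∷ outNeighbours s ++ inNeighbours s

  Arc⇒∈outNeighbours : ∀ (s v : Word d (3 + n)) → Constrained₃ v → Arc s v → v ∈ outNeighbours s
  Arc⇒∈outNeighbours s@(_ ∷ t) v v-con arc
    with v≡ ← Arc⇒≡tail∷ʳ s v arc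
    with c≢l , c≢p ← Constrained₃-∷ʳ⁻ t (subst Constrained₃ v≡ v-con) =
    subst (_∈ outNeighbours s) (sym v≡) (∈-map⁺ (t ∷ʳ_) (∈-others₂⁺ c≢l c≢p))

  Arc⇒∈inNeighbours : ∀ (s v : Word d (3 + n)) → Constrained₃ v → Arc v s → v ∈ inNeighbours s
  Arc⇒∈inNeighbours s@(_ ∷ _ ∷ _) v v-con arc
    with v≡ ← Arc⇒≡∷init v s arc
    with c≢s₀ , c≢s₁ , _ ← subst Constrained₃ v≡ v-con =
    subst (_∈ inNeighbours s) (sym v≡) (∈-map⁺ (_∷ init s) (∈-others₂⁺ c≢s₀ c≢s₁))

  ∈-closedNeighbourhood : ∀ (s v : Word d (3 + n)) → Constrained₃ v →
                          s ≡ v ⊎ Arc s v ⊎ Arc v s → v ∈ closedNeighbourhood s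
  ∈-closedNeighbourhood s v _     (inj₁ refl)       = here refl
  ∈-closedNeighbourhood s v v-con (inj₂ (inj₁ arc)) = there (∈-++⁺ˡ (Arc⇒∈outNeighbours s v v-con arc))
  ∈-closedNeighbourhood s v v-con (inj₂ (inj₂ arc)) =
    there (∈-++⁺ʳ (outNeighbours s) (Arc⇒∈inNeighbours s v v-con arc))

  length-closedNeighbourhood : ∀ (s : Word d (3 + n)) → Constrained₃ s →
                               length (closedNeighbourhood s) ≡ suc ((d ∸ 2) + (d ∸ 2))
  length-closedNeighbourhood s@(s₀ ∷ t@(s₁ ∷ r)) s-con = cong suc (begin
    length (outNeighbours s ++ inNeighbours s)
      ≡⟨ length-++ (outNeighbours s) ⟩
    length (outNeighbours s) + length (inNeighbours s)
      ≡⟨ cong₂ _+_ (length-map (t ∷ʳ_) (others₂ (last t) (penultimate t)))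
                   (length-map (_∷ init s) (others₂ s₀ s₁)) ⟩
    length (others₂ (last t) (penultimate t)) + length (others₂ s₀ s₁)
      ≡⟨ cong₂ _+_ (length-others₂ (Constrained₃-last t (Constrained₃-tail s₀ t s-con)))
                   (length-others₂ (≢-sym (Constrained₃-head r s-con))) ⟩
    (d ∸ 2) + (d ∸ 2) ∎)
    where open ≡-Reasoning

  dominating-set-covers : ∀ {S : List (Word d (3 + n))} → IsDominatingSet d 3 (3 + n) S →
                          constrainedWords (suc n) ⊆ concatMap closedNeighbourhood S
  dominating-set-covers (_ , _ , dominates) {v} v∈
    with v-con ← ∈-constrainedWords⁻ v v∈
    with s , s∈S , s≈v ← dominates v (Constrained₃⇒Constrained v v-con) =
    ∈-concatMap⁺ closedNeighbourhood (lose s∈S (∈-closedNeighbourhood s v v-con (edge s≈v)))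
    where
    edge : ∀ {s} → s ≡ v ⊎ Adj 3 s v → s ≡ v ⊎ Arc s v ⊎ Arc v s
    edge (inj₁ s≡v)               = inj₁ s≡v
    edge (inj₂ (_ , _ , _ , arc)) = inj₂ arc

  dominating-set-lower-bound : ∀ {n} {S : List (Word d (3 + n))} →
                               2 ≤ d → IsDominatingSet d 3 (3 + n) S →
                               d * (d ∸ 1) * (d ∸ 2) ^ suc n ≤ (2 * d ∸ 3) * length S
  dominating-set-lower-bound {n} {S} 2≤d S-dom@(_ , S-con , _) = begin
    d * (d ∸ 1) * (d ∸ 2) ^ suc n
      ≡⟨ *-assoc d (d ∸ 1) _ ⟩
    d * ((d ∸ 1) * (d ∸ 2) ^ suc n)
      ≡⟨ length-constrainedWords (suc n) ⟨
    length (constrainedWords (suc n))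
      ≤⟨ ⊆⇒length-≤ (constrainedWords-unique (suc n)) (dominating-set-covers S-dom) ⟩
    length (concatMap closedNeighbourhood S)
      ≡⟨ length-concatMap closedNeighbourhood S (λ {s} s∈S →
           length-closedNeighbourhood s (Constrained⇒Constrained₃ s (All-lookup S-con s∈S))) ⟩
    length S * suc ((d ∸ 2) + (d ∸ 2))
      ≡⟨ *-comm (length S) _ ⟩
    suc ((d ∸ 2) + (d ∸ 2)) * length S
      ≡⟨ cong (_* length S) (degree-bound 2≤d) ⟩
    (2 * d ∸ 3) * length S ∎
    where
    open ≤-Reasoning
    degree-bound : ∀ {d} → 2 ≤ d → suc ((d ∸ 2) + (d ∸ 2)) ≡ 2 * d ∸ 3
    degree-bound {suc (suc e)} (s≤s (s≤s _)) rewrite +-identityʳ e | +-suc e (suc e) | +-suc e e = refl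

  startingWith : Fin d → (m : ℕ) → List (Word d (2 + m))
  startingWith a m = map (a ∷_) (extensions a m)

  ∈-startingWith⁺ : ∀ {a} (r : Word d (suc m)) → Constrained₃ (a ∷ r) → a ∷ r ∈ startingWith a m
  ∈-startingWith⁺ {a = a} r con = ∈-map⁺ (a ∷_) (∈-extensions⁺ r con)

  ∈-startingWith⁻ : ∀ {a} {s : Word d (2 + m)} → s ∈ startingWith a m → Constrained₃ s
  ∈-startingWith⁻ {a = a} s∈ with r , r∈ , refl ← ∈-map⁻ (a ∷_) s∈ = ∈-extensions⁻ r r∈

  length-startingWith : ∀ a m → length (startingWith a m) ≡ (d ∸ 1) * (d ∸ 2) ^ m
  length-startingWith a m = trans (length-map (a ∷_) (extensions a m)) (length-extensions a m)

  fresh : 3 ≤ d → ∀ {p q : Fin d} → q ≢ p → ∃ λ c → c ≢ p × c ≢ q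
  fresh 3≤d {p} {q} q≢p =
    let c , c∈ = length≥1⇒∃∈ (subst (1 ≤_) (sym (length-others₂ q≢p)) (∸-monoˡ-≤ 2 3≤d))
    in c , ∈-others₂⁻ c∈

  dominated-by-startingWith : 3 ≤ d → ∀ a (v : Word d (3 + n)) → Constrained₃ v →
                              Dominated 3 (startingWith a (suc n)) v
  dominated-by-startingWith 3≤d a v@(v₀ ∷ v₁ ∷ r) v-con with v₀ ≟ a | v₁ ≟ a
  ... | yes refl | _ = v , ∈-startingWith⁺ (v₁ ∷ r) v-con , inj₁ refl
  ... | no v₀≢a | yes refl
    with t-con ← Constrained₃-tail v₀ (a ∷ r) v-con
    with c , c≢l , c≢p ← fresh 3≤d (Constrained₃-last (a ∷ r) t-con)
    with s-con ← Constrained₃-∷ʳ⁺ (a ∷ r) t-con c≢l c≢p =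
    a ∷ (r ∷ʳ c) , ∈-startingWith⁺ (r ∷ʳ c) s-con ,
    inj₂ (adjacent s-con v-con (≢-sym v₀≢a) (inj₂ (Arc-∷ʳ v₀ (a ∷ r) c)))
  ... | no v₀≢a | no v₁≢a
    with s-con ← (≢-sym v₀≢a , ≢-sym v₁≢a , Constrained₃-init v v-con) =
    a ∷ init v , ∈-startingWith⁺ (init v) s-con ,
    inj₂ (adjacent s-con v-con (≢-sym v₀≢a) (inj₁ (Arc-∷init a v)))

  startingWith-isDominatingSet : 3 ≤ d → ∀ a → IsDominatingSet d 3 (3 + n) (startingWith a (suc n))
  startingWith-isDominatingSet 3≤d a =
    map⁺ ∷-injectiveʳ (extensions-unique a _) ,
    All-tabulate (λ {s} s∈ → Constrained₃⇒Constrained s (∈-startingWith⁻ s∈)) ,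
    λ v v-con → dominated-by-startingWith 3≤d a v (Constrained⇒Constrained₃ v v-con)

theorem10 : (d n : ℕ) → 3 ≤ d → 4 ≤ n →
    ((S : List (Word d n)) → IsDominatingSet d 3 n S →
      d * (d ∸ 1) * (d ∸ 2) ^ (n ∸ 2) ≤ (2 * d ∸ 3) * length S)
    × (∃ λ (S : List (Word d n)) → IsDominatingSet d 3 n S
         × length S ≤ (d ∸ 1) * (d ∸ 2) ^ (n ∸ 2))
theorem10 d@(suc _) (suc (suc (suc k))) 3≤d (s≤s (s≤s (s≤s _))) =
  (λ S → dominating-set-lower-bound (≤-trans (n≤1+n 2) 3≤d)) ,
  (startingWith zero (suc k) , startingWith-isDominatingSet 3≤d zero ,
   ≤-reflexive (length-startingWith {d = d} zero (suc k)))
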